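{- Let $n \ge 2$. For any two distinct vertices $X$ and $Y$ of the polytope $\Omega_n$, the convex hull of $\{X, Y\}$ is an edge (a one-dimensional face) of $\Omega_n$.
   Context: Fix an integer $n \ge 2$. Consider the rational affine space $\mathbb{Q}^{4n^2}$ whose coordinates are indexed as $X_{ijpq}$ with $i,j \in \{1,\dots,n\}$ and $p,q \in \{1,2\}$. For each function $\rho:\{1,\dots,n\}\to\{1,2\}$ define the point $X^{\rho}$ by $X^{\rho}_{ijpq}=1$ if $p=\rho(i)$ and $q=\rho(j)$, and $X^{\rho}_{ijpq}=0$ otherwise. The polytope $\Omega_n \subset \mathbb{Q}^{4n^2}$ is the convex hull of all the points $X^{\rho}$. A face of a polytope $\Pi$ is either empty, $\Pi$ itself, or the intersection of $\Pi$ with a supporting hyperplane (a hyperplane one of whose closed half-spaces contains $\Pi$); an edge is a face of dimension $1$. -}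

module Defs where

open import Data.Nat using (ℕ)
open import Data.Fin using (Fin; zero; suc)
open import Data.Rational using (ℚ; 0ℚ; 1ℚ; _+_; _*_; _≤_)
open import Data.Product using (Σ; ∃; _×_; _,_)
open import Data.Sum using (_⊎_)
open import Data.List using (List; []; _∷_)
open import Data.List.Relation.Unary.All using (All)
open import Data.Empty using (⊥)
open import Relation.Nullary using (¬_)
open import Relation.Binary.PropositionalEquality using (_≡_)
open import Function.Bundles using (_⇔_)

-- A point of ℚ^{4n²}, coordinates X_{ijpq}, i,j ∈ Fin n, p,q ∈ Fin 2
-- (Fin 2 = {zero, suc zero} stands for {1,2}).
Point : ℕ → Set
Point n = Fin n → Fin n → Fin 2 → Fin 2 → ℚ

_≈_ : ∀ {n} → Point n → Point n → Set
X ≈ Y = ∀ i j p q → X i j p q ≡ Y i j p q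

PSet : ℕ → Set₁
PSet n = Point n → Set

δ : ∀ {k} → Fin k → Fin k → ℚ
δ zero zero = 1ℚ
δ zero (suc _) = 0ℚ
δ (suc _) zero = 0ℚ
δ (suc a) (suc b) = δ a b

Xρ : ∀ {n} → (Fin n → Fin 2) → Point n
Xρ ρ i j p q = δ p (ρ i) * δ q (ρ j)

sumFin : ∀ {m} → (Fin m → ℚ) → ℚ
sumFin {ℕ.zero} f = 0ℚ
sumFin {ℕ.suc m} f = f zero + sumFin (λ k → f (suc k))

sumList : ∀ {A : Set} → (A → ℚ) → List A → ℚ
sumList f [] = 0ℚ
sumList f (a ∷ as) = f a + sumList f as

dot : ∀ {n} → Point n → Point n → ℚ
dot c z = sumFin λ i → sumFin λ j → sumFin λ p → sumFin λ q → c i j p q * z i j p q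

zeroPt : ∀ {n} → Point n
zeroPt _ _ _ _ = 0ℚ

InConv : ∀ {n} → PSet n → PSet n
InConv {n} S z =
  Σ (List (ℚ × Point n)) λ ws →
    All (λ { (λ' , x) → (0ℚ ≤ λ') × S x }) ws
    × sumList (λ { (λ' , _) → λ' }) ws ≡ 1ℚ
    × (∀ i j p q → z i j p q ≡ sumList (λ { (λ' , x) → λ' * x i j p q }) ws)

Ω : (n : ℕ) → PSet n
Ω n = InConv (λ x → Σ (Fin n → Fin 2) λ ρ → x ≈ Xρ ρ)

Seg : ∀ {n} → Point n → Point n → PSet n
Seg X Y = InConv (λ x → (x ≈ X) ⊎ (x ≈ Y))

_≐_ : ∀ {n} → PSet n → PSet n → Set
F ≐ G = ∀ z → F z ⇔ G z

IsFace : ∀ {n} → PSet n → PSet n → Set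
IsFace {n} P F =
  (∀ z → ¬ F z)
  ⊎ (F ≐ P)
  ⊎ Σ (Point n) λ c → Σ ℚ λ b →
      ¬ (c ≈ zeroPt)
      × (∀ z → P z → dot c z ≤ b)
      × (F ≐ (λ z → P z × dot c z ≡ b))

IsVertex : ∀ {n} → PSet n → Point n → Set
IsVertex P v = IsFace P (λ z → z ≈ v)

{-# OPTIONS --safe #-}
module Submission where

-- Every vertex of Ω_n is one of the points X^ρ, since a face cut out by a supporting
-- hyperplane is the convex hull of the generators lying on that hyperplane. For
-- X = X^ρ and Y = X^σ take the normal c with c_{ijpq} = 1 if (p, q) is (ρ i, ρ j) or
-- (σ i, σ j) and 0 otherwise. Then c·X^τ counts the pairs (i, j) with
-- (τ i, τ j) ∈ {(ρ i, ρ j), (σ i, σ j)}, so c·X^τ ≤ n², with equality iff this holds for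
-- all i, j. If τ i₀ ≠ ρ i₀ for some i₀, the pairs (i₀, j) force τ j = σ j for every j;
-- hence c·X^τ = n² exactly when τ ∈ {ρ, σ}, and the exposed face is conv {X, Y}.

open import Defs
open import Algebra using (CommutativeMonoid)
open import Data.Fin using (Fin; zero; suc; fromℕ<; _≟_)
open import Data.Fin.Properties using (all?; ¬∀⟶∃¬)
open import Data.List using (List; []; _∷_)
open import Data.List.Relation.Unary.All as All using (All; []; _∷_)
open import Data.Nat using (ℕ; _≤_; s≤s; z≤n)
open import Data.Nat.Properties using (≤-trans)
open import Data.Product using (∃; _×_; _,_; proj₁; proj₂)
open import Data.Rational using (ℚ; 0ℚ; 1ℚ; _+_; _*_; 1/_; NonZero; ≢-nonZero; nonNegative)
  renaming (_≤_ to _≤ℚ_)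
import Data.Rational.Properties as ℚ
open import Data.Sum using (_⊎_; inj₁; inj₂; [_,_]′)
open import Data.Empty using (⊥-elim)
open import Function.Bundles using (mk⇔; Equivalence)
open import Function.Properties.Equivalence using () renaming (trans to ⇔-trans)
open import Relation.Binary.Definitions using (DecidableEquality)
open import Relation.Binary.PropositionalEquality
open import Relation.Nullary using (¬_; Dec; yes; no; contradiction)
open import Relation.Nullary.Decidable using (_×-dec_; _⊎-dec_)
open import Algebra.Properties.CommutativeSemigroup
  (CommutativeMonoid.commutativeSemigroup ℚ.+-0-commutativeMonoid) using (interchange)
open import Algebra.Properties.CommutativeSemigroup
  (CommutativeMonoid.commutativeSemigroup ℚ.*-1-commutativeMonoid) using (x∙yz≈y∙xz)

open Equivalence using (to; from)

+-tight : ∀ {a b c d : ℚ} → a ≤ℚ b → c ≤ℚ d → a + c ≡ b + d → a ≡ b × c ≡ d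
+-tight a≤b c≤d eq =
    ℚ.≤-antisym a≤b (ℚ.≮⇒≥ λ a<b → ℚ.<⇒≢ (ℚ.+-mono-<-≤ a<b c≤d) eq)
  , ℚ.≤-antisym c≤d (ℚ.≮⇒≥ λ c<d → ℚ.<⇒≢ (ℚ.+-mono-≤-< a≤b c<d) eq)

*-cancelˡ-≡ : ∀ a {b c : ℚ} → a ≢ 0ℚ → a * b ≡ a * c → b ≡ c
*-cancelˡ-≡ a {b} {c} a≢0 eq = begin
  b                  ≡⟨ sym (ℚ.*-identityˡ b) ⟩
  1ℚ * b             ≡⟨ cong (_* b) (sym (ℚ.*-inverseˡ a)) ⟩
  (1/ a * a) * b     ≡⟨ ℚ.*-assoc (1/ a) a b ⟩
  1/ a * (a * b)     ≡⟨ cong (1/ a *_) eq ⟩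
  1/ a * (a * c)     ≡⟨ sym (ℚ.*-assoc (1/ a) a c) ⟩
  (1/ a * a) * c     ≡⟨ cong (_* c) (ℚ.*-inverseˡ a) ⟩
  1ℚ * c             ≡⟨ ℚ.*-identityˡ c ⟩
  c                  ∎
  where
  open ≡-Reasoning
  instance
    a-nonZero : NonZero a
    a-nonZero = ≢-nonZero a≢0

indicator : ∀ {P : Set} → Dec P → ℚ
indicator (yes _) = 1ℚ
indicator (no _)  = 0ℚ

indicator≤1 : ∀ {P : Set} (P? : Dec P) → indicator P? ≤ℚ 1ℚ
indicator≤1 (yes _) = ℚ.≤-refl
indicator≤1 (no _)  = ℚ.nonNegative⁻¹ 1ℚ

indicator≡1⇒ : ∀ {P : Set} (P? : Dec P) → indicator P? ≡ 1ℚ → P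
indicator≡1⇒ (yes p) _   = p
indicator≡1⇒ (no _)  0≡1 = contradiction (sym 0≡1) ℚ.1≢0

⇒indicator≡1 : ∀ {P : Set} (P? : Dec P) → P → indicator P? ≡ 1ℚ
⇒indicator≡1 (yes _) _ = refl
⇒indicator≡1 (no ¬p) p = contradiction p ¬p

sumFin-cong : ∀ {m} {f g : Fin m → ℚ} → (∀ k → f k ≡ g k) → sumFin f ≡ sumFin g
sumFin-cong {ℕ.zero}  _   = refl
sumFin-cong {ℕ.suc _} f≗g = cong₂ _+_ (f≗g zero) (sumFin-cong (λ k → f≗g (suc k)))

sumFin-0 : ∀ {m} → sumFin {m} (λ _ → 0ℚ) ≡ 0ℚ
sumFin-0 {ℕ.zero}  = refl
sumFin-0 {ℕ.suc m} = trans (ℚ.+-identityˡ (sumFin {m} λ _ → 0ℚ)) (sumFin-0 {m})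

sumFin-+ : ∀ {m} (f g : Fin m → ℚ) → sumFin (λ k → f k + g k) ≡ sumFin f + sumFin g
sumFin-+ {ℕ.zero}  _ _ = refl
sumFin-+ {ℕ.suc _} f g =
  trans (cong (f zero + g zero +_) (sumFin-+ (λ k → f (suc k)) (λ k → g (suc k))))
        (interchange (f zero) (g zero) _ _)

sumFin-*ˡ : ∀ {m} a (f : Fin m → ℚ) → sumFin (λ k → a * f k) ≡ a * sumFin f
sumFin-*ˡ {ℕ.zero}  a _ = sym (ℚ.*-zeroʳ a)
sumFin-*ˡ {ℕ.suc _} a f =
  trans (cong (a * f zero +_) (sumFin-*ˡ a (λ k → f (suc k))))
        (sym (ℚ.*-distribˡ-+ a (f zero) _))

sumFin-mono-≤ : ∀ {m} {f g : Fin m → ℚ} → (∀ k → f k ≤ℚ g k) → sumFin f ≤ℚ sumFin g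
sumFin-mono-≤ {ℕ.zero}  _   = ℚ.≤-refl
sumFin-mono-≤ {ℕ.suc _} f≤g = ℚ.+-mono-≤ (f≤g zero) (sumFin-mono-≤ (λ k → f≤g (suc k)))

sumFin-tight : ∀ {m} {f g : Fin m → ℚ} → (∀ k → f k ≤ℚ g k) → sumFin f ≡ sumFin g →
               ∀ k → f k ≡ g k
sumFin-tight {ℕ.suc _} f≤g eq = λ where
    zero    → proj₁ head-tail
    (suc k) → sumFin-tight (λ k → f≤g (suc k)) (proj₂ head-tail) k
  where head-tail = +-tight (f≤g zero) (sumFin-mono-≤ (λ k → f≤g (suc k))) eq

sumFin-δ : ∀ {m} (f : Fin m → ℚ) a → sumFin (λ k → δ k a * f k) ≡ f a
sumFin-δ {ℕ.suc _} f zero = begin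
  1ℚ * f zero + sumFin (λ k → 0ℚ * tail k)
    ≡⟨ cong₂ _+_ (ℚ.*-identityˡ (f zero)) (sumFin-*ˡ 0ℚ tail) ⟩
  f zero + 0ℚ * sumFin tail
    ≡⟨ cong (f zero +_) (ℚ.*-zeroˡ (sumFin tail)) ⟩
  f zero + 0ℚ
    ≡⟨ ℚ.+-identityʳ (f zero) ⟩
  f zero ∎
  where
  open ≡-Reasoning
  tail = λ k → f (suc k)
sumFin-δ {ℕ.suc _} f (suc a) =
  trans (cong₂ _+_ (ℚ.*-zeroˡ (f zero)) (sumFin-δ (λ k → f (suc k)) a))
        (ℚ.+-identityˡ (f (suc a)))

sumList-cong : ∀ {A : Set} {f g : A → ℚ} {ws} →
  All (λ w → f w ≡ g w) ws → sumList f ws ≡ sumList g ws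
sumList-cong []         = refl
sumList-cong (eq ∷ eqs) = cong₂ _+_ eq (sumList-cong eqs)

sumList-mono-≤ : ∀ {A : Set} {f g : A → ℚ} {ws} →
  All (λ w → f w ≤ℚ g w) ws → sumList f ws ≤ℚ sumList g ws
sumList-mono-≤ []         = ℚ.≤-refl
sumList-mono-≤ (le ∷ les) = ℚ.+-mono-≤ le (sumList-mono-≤ les)

sumList-tight : ∀ {A : Set} {f g : A → ℚ} {ws} → All (λ w → f w ≤ℚ g w) ws →
                sumList f ws ≡ sumList g ws → All (λ w → f w ≡ g w) ws
sumList-tight []         _  = []
sumList-tight (le ∷ les) eq =
  let (head≡ , tail≡) = +-tight le (sumList-mono-≤ les) eq in head≡ ∷ sumList-tight les tail≡

sumList-*ʳ : ∀ {A : Set} b (f : A → ℚ) ws → sumList (λ w → f w * b) ws ≡ sumList f ws * b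
sumList-*ʳ b _ []       = sym (ℚ.*-zeroˡ b)
sumList-*ʳ b f (w ∷ ws) =
  trans (cong (f w * b +_) (sumList-*ʳ b f ws)) (sym (ℚ.*-distribʳ-+ b (f w) _))

sumFin-combination : ∀ {m} {A : Set} (ws : List (ℚ × A)) (g : A → Fin m → ℚ) →
  sumFin (λ k → sumList (λ w → proj₁ w * g (proj₂ w) k) ws) ≡
  sumList (λ w → proj₁ w * sumFin (g (proj₂ w))) ws
sumFin-combination {m} []             _ = sumFin-0 {m}
sumFin-combination      ((a , x) ∷ ws) g =
  trans (sumFin-+ (λ k → a * g x k) (λ k → sumList (λ w → proj₁ w * g (proj₂ w) k) ws))
        (cong₂ _+_ (sumFin-*ˡ a (g x)) (sumFin-combination ws g))

*-combination : ∀ {A : Set} a (ws : List (ℚ × A)) (g : A → ℚ) →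
  a * sumList (λ w → proj₁ w * g (proj₂ w)) ws ≡
  sumList (λ w → proj₁ w * (a * g (proj₂ w))) ws
*-combination a []             _ = ℚ.*-zeroʳ a
*-combination a ((b , x) ∷ ws) g =
  trans (ℚ.*-distribˡ-+ a (b * g x) _) (cong₂ _+_ (x∙yz≈y∙xz a b (g x)) (*-combination a ws g))

module _ {n : ℕ} where

  ≈-refl : {x : Point n} → x ≈ x
  ≈-refl _ _ _ _ = refl

  ≈-sym : {x y : Point n} → x ≈ y → y ≈ x
  ≈-sym x≈y i j p q = sym (x≈y i j p q)

  ≈-trans : {x y z : Point n} → x ≈ y → y ≈ z → x ≈ z
  ≈-trans x≈y y≈z i j p q = trans (x≈y i j p q) (y≈z i j p q)

  totalWeight : List (ℚ × Point n) → ℚ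
  totalWeight = sumList proj₁

  combination : List (ℚ × Point n) → Point n
  combination ws i j p q = sumList (λ w → proj₁ w * proj₂ w i j p q) ws

  dot-cong : (c : Point n) {x y : Point n} → x ≈ y → dot c x ≡ dot c y
  dot-cong c x≈y =
    sumFin-cong λ i → sumFin-cong λ j → sumFin-cong λ p → sumFin-cong λ q →
      cong (c i j p q *_) (x≈y i j p q)

  dot-combination : (c : Point n) (ws : List (ℚ × Point n)) →
    dot c (combination ws) ≡ sumList (λ w → proj₁ w * dot c (proj₂ w)) ws
  dot-combination c ws =
    trans (sumFin-cong λ i →
      trans (sumFin-cong λ j →
        trans (sumFin-cong λ p →
          trans (sumFin-cong λ q → *-combination (c i j p q) ws (λ x → x i j p q))
                (sumFin-combination ws λ x q → c i j p q * x i j p q))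
              (sumFin-combination ws λ x p → sumFin λ q → c i j p q * x i j p q))
            (sumFin-combination ws λ x j → sumFin λ p → sumFin λ q → c i j p q * x i j p q))
          (sumFin-combination ws λ x i → sumFin λ j → sumFin λ p → sumFin λ q → c i j p q * x i j p q)

  WeightedIn : PSet n → ℚ × Point n → Set
  WeightedIn S w = 0ℚ ≤ℚ proj₁ w × S (proj₂ w)

  InConv-mono : {S T : PSet n} → (∀ {x} → S x → T x) → ∀ {z} → InConv S z → InConv T z
  InConv-mono S⊆T (ws , inS , weight≡1 , z≈) =
    ws , All.map (λ (0≤a , x∈S) → 0≤a , S⊆T x∈S) inS , weight≡1 , z≈

  InConv-cong : {S T : PSet n} → S ≐ T → InConv S ≐ InConv T
  InConv-cong S≐T _ = mk⇔ (InConv-mono (to (S≐T _))) (InConv-mono (from (S≐T _)))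

  ∈⇒InConv : {S : PSet n} {x : Point n} → S x → InConv S x
  ∈⇒InConv x∈S = (1ℚ , _) ∷ [] , (ℚ.nonNegative⁻¹ 1ℚ , x∈S) ∷ [] , ℚ.+-identityʳ 1ℚ ,
    λ i j p q → sym (trans (ℚ.+-identityʳ _) (ℚ.*-identityˡ _))

  InConv-nonempty : {S : PSet n} {z : Point n} → InConv S z → ∃ S
  InConv-nonempty ([] , [] , () , _)
  InConv-nonempty ((_ , x) ∷ _ , (_ , x∈S) ∷ _ , _) = x , x∈S

  dot-InConv : (c : Point n) {S : PSet n} {z : Point n} ((ws , _) : InConv S z) →
    dot c z ≡ sumList (λ w → proj₁ w * dot c (proj₂ w)) ws
  dot-InConv c (ws , _ , _ , z≈) = trans (dot-cong c z≈) (dot-combination c ws)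

  combination-const : (b : ℚ) (ws : List (ℚ × Point n)) → totalWeight ws ≡ 1ℚ →
    sumList (λ w → proj₁ w * b) ws ≡ b
  combination-const b ws weight≡1 =
    trans (sumList-*ʳ b proj₁ ws) (trans (cong (_* b) weight≡1) (ℚ.*-identityˡ b))

  module _ {S : PSet n} (c : Point n) (b : ℚ) (bounded : ∀ x → S x → dot c x ≤ℚ b) where

    private
      weighted-bound : ∀ {w} → WeightedIn S w → proj₁ w * dot c (proj₂ w) ≤ℚ proj₁ w * b
      weighted-bound {a , x} (0≤a , x∈S) = ℚ.*-monoˡ-≤-nonNeg a {{nonNegative 0≤a}} (bounded x x∈S)

    InConv-bounded : ∀ z → InConv S z → dot c z ≤ℚ b
    InConv-bounded z h@(ws , inS , weight≡1 , _) = begin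
      dot c z                                     ≡⟨ dot-InConv c h ⟩
      sumList (λ w → proj₁ w * dot c (proj₂ w)) ws ≤⟨ sumList-mono-≤ (All.map weighted-bound inS) ⟩
      sumList (λ w → proj₁ w * b) ws               ≡⟨ combination-const b ws weight≡1 ⟩
      b                                            ∎
      where open ℚ.≤-Reasoning

    InConv-tight : ∀ {z} ((ws , _) : InConv S z) → dot c z ≡ b →
      All (λ w → proj₁ w ≢ 0ℚ → dot c (proj₂ w) ≡ b) ws
    InConv-tight h@(ws , inS , weight≡1 , _) cz≡b =
      All.map (λ eq a≢0 → *-cancelˡ-≡ _ a≢0 eq)
        (sumList-tight (All.map weighted-bound inS)
          (trans (sym (dot-InConv c h)) (trans cz≡b (sym (combination-const b ws weight≡1)))))

  dropZeroWeights : {S T : PSet n} (ws : List (ℚ × Point n)) → All (WeightedIn S) ws →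
    All (λ w → proj₁ w ≢ 0ℚ → T (proj₂ w)) ws →
    ∃ λ vs → All (WeightedIn T) vs × totalWeight vs ≡ totalWeight ws ×
             combination vs ≈ combination ws
  dropZeroWeights [] [] [] = [] , [] , refl , ≈-refl
  dropZeroWeights ((a , x) ∷ ws) ((0≤a , _) ∷ inS) (onT ∷ onTs)
    with dropZeroWeights ws inS onTs | a ℚ.≟ 0ℚ
  ... | vs , inT , weight≡ , vs≈ws | yes refl =
    vs , inT , trans weight≡ (sym (ℚ.+-identityˡ _)) ,
    λ i j p q → trans (vs≈ws i j p q)
                      (sym (trans (cong (_+ _) (ℚ.*-zeroˡ (x i j p q))) (ℚ.+-identityˡ _)))
  ... | vs , inT , weight≡ , vs≈ws | no a≢0 =
    (a , x) ∷ vs , (0≤a , onT a≢0) ∷ inT , cong (a +_) weight≡ ,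
    λ i j p q → cong (a * x i j p q +_) (vs≈ws i j p q)

  InConv-support : {S T : PSet n} {z : Point n} ((ws , _) : InConv S z) →
    All (λ w → proj₁ w ≢ 0ℚ → T (proj₂ w)) ws → InConv T z
  InConv-support (ws , inS , weight≡1 , z≈) onT with dropZeroWeights ws inS onT
  ... | vs , inT , weight≡ , vs≈ws =
    vs , inT , trans weight≡ weight≡1 , ≈-trans z≈ (≈-sym vs≈ws)

  InConv-face : {S : PSet n} (c : Point n) (b : ℚ) → (∀ x → S x → dot c x ≤ℚ b) →
    InConv (λ x → S x × dot c x ≡ b) ≐ (λ z → InConv S z × dot c z ≡ b)
  InConv-face {S} c b bounded z = mk⇔ onFace toHull
    where
    onFace : InConv (λ x → S x × dot c x ≡ b) z → InConv S z × dot c z ≡ b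
    onFace h@(ws , inF , weight≡1 , _) =
        InConv-mono proj₁ h
      , trans (dot-InConv c h)
          (trans (sumList-cong (All.map (λ {(a , _)} (_ , _ , cx≡b) → cong (a *_) cx≡b) inF))
                 (combination-const b ws weight≡1))

    toHull : InConv S z × dot c z ≡ b → InConv (λ x → S x × dot c x ≡ b) z
    toHull (h@(ws , inS , _) , cz≡b) =
      InConv-support h (All.zipWith (λ ((_ , x∈S) , tight) a≢0 → x∈S , tight a≢0)
                                   (inS , InConv-tight c b bounded h cz≡b))

  InConv-vertex : {S : PSet n} {v : Point n} → IsVertex (InConv S) v → ∃ λ x → S x × x ≈ v
  InConv-vertex (inj₁ empty) = ⊥-elim (empty _ ≈-refl)
  InConv-vertex {v = v} (inj₂ (inj₁ v≐hull)) with InConv-nonempty (to (v≐hull v) ≈-refl)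
  ... | x , x∈S = x , x∈S , from (v≐hull x) (∈⇒InConv x∈S)
  InConv-vertex {v = v} (inj₂ (inj₂ (c , b , _ , bounded , v≐face)))
    with InConv-nonempty (from (InConv-face c b (λ x x∈S → bounded x (∈⇒InConv x∈S)) v)
                               (to (v≐face v) ≈-refl))
  ... | x , x∈S , cx≡b = x , x∈S , from (v≐face x) (∈⇒InConv x∈S , cx≡b)

cells : ℕ → ℚ
cells n = sumFin {n} λ _ → sumFin {n} λ _ → 1ℚ

module _ {n : ℕ} {R : Fin n → Fin n → Set} (R? : ∀ i j → Dec (R i j)) where

  count : ℚ
  count = sumFin λ i → sumFin λ j → indicator (R? i j)

  private
    row≤ : ∀ i → sumFin (λ j → indicator (R? i j)) ≤ℚ sumFin {n} (λ _ → 1ℚ)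
    row≤ i = sumFin-mono-≤ λ j → indicator≤1 (R? i j)

  count≤cells : count ≤ℚ cells n
  count≤cells = sumFin-mono-≤ row≤

  count≡cells⇒ : count ≡ cells n → ∀ i j → R i j
  count≡cells⇒ eq i j =
    indicator≡1⇒ (R? i j) (sumFin-tight (λ j → indicator≤1 (R? i j)) (sumFin-tight row≤ eq i) j)

  ⇒count≡cells : (∀ i j → R i j) → count ≡ cells n
  ⇒count≡cells r = sumFin-cong λ i → sumFin-cong λ j → ⇒indicator≡1 (R? i j) (r i j)

OnEdge : ∀ {A : Set} {n} (ρ σ : Fin n → A) → Fin n → Fin n → A → A → Set
OnEdge ρ σ i j p q = (p ≡ ρ i × q ≡ ρ j) ⊎ (p ≡ σ i × q ≡ σ j)

onEdge⇒≗⊎≗ : ∀ {A : Set} {n} → DecidableEquality A → {τ ρ σ : Fin n → A} →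
  (∀ i j → OnEdge ρ σ i j (τ i) (τ j)) → τ ≗ ρ ⊎ τ ≗ σ
onEdge⇒≗⊎≗ {n = n} _≟ᴬ_ {τ} {ρ} onEdge with all? (λ i → τ i ≟ᴬ ρ i)
... | yes τ≗ρ = inj₁ τ≗ρ
... | no τ≉ρ with ¬∀⟶∃¬ n _ (λ i → τ i ≟ᴬ ρ i) τ≉ρ
... | i , τi≢ρi =
  inj₂ λ j → [ (λ (τi≡ρi , _) → contradiction τi≡ρi τi≢ρi) , proj₂ ]′ (onEdge i j)

IsXρ : ∀ {n} → PSet n
IsXρ {n} x = ∃ λ (ρ : Fin n → Fin 2) → x ≈ Xρ ρ

Ω-vertex : ∀ {n} {X : Point n} → IsVertex (Ω n) X → ∃ λ ρ → X ≈ Xρ ρ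
Ω-vertex vX with InConv-vertex vX
... | _ , (ρ , x≈Xρ) , x≈X = ρ , ≈-trans (≈-sym x≈X) x≈Xρ

Xρ-cong : ∀ {n} {τ ρ : Fin n → Fin 2} → τ ≗ ρ → Xρ τ ≈ Xρ ρ
Xρ-cong τ≗ρ i j p q = cong₂ (λ a b → δ p a * δ q b) (τ≗ρ i) (τ≗ρ j)

dot-Xρ : ∀ {n} (c : Point n) τ → dot c (Xρ τ) ≡ sumFin λ i → sumFin λ j → c i j (τ i) (τ j)
dot-Xρ c τ = sumFin-cong λ i → sumFin-cong λ j → sift (c i j) (τ i) (τ j)
  where
  open ≡-Reasoning
  sift : ∀ (g : Fin 2 → Fin 2 → ℚ) a b →
    sumFin (λ p → sumFin λ q → g p q * (δ p a * δ q b)) ≡ g a b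
  sift g a b = begin
    sumFin (λ p → sumFin λ q → g p q * (δ p a * δ q b))
      ≡⟨ sumFin-cong (λ p → sumFin-cong λ q →
           trans (ℚ.*-comm (g p q) (δ p a * δ q b)) (ℚ.*-assoc (δ p a) (δ q b) (g p q))) ⟩
    sumFin (λ p → sumFin λ q → δ p a * (δ q b * g p q))
      ≡⟨ sumFin-cong (λ p → trans (sumFin-*ˡ (δ p a) (λ q → δ q b * g p q))
                                  (cong (δ p a *_) (sumFin-δ (g p) b))) ⟩
    sumFin (λ p → δ p a * g p b)
      ≡⟨ sumFin-δ (λ p → g p b) a ⟩
    g a b ∎

module Edge {n : ℕ} (ρ σ : Fin n → Fin 2) where

  onEdge? : ∀ i j p q → Dec (OnEdge ρ σ i j p q)
  onEdge? i j p q = (p ≟ ρ i ×-dec q ≟ ρ j) ⊎-dec (p ≟ σ i ×-dec q ≟ σ j)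

  normal : Point n
  normal i j p q = indicator (onEdge? i j p q)

  onEdgeAt? : (τ : Fin n → Fin 2) → ∀ i j → Dec (OnEdge ρ σ i j (τ i) (τ j))
  onEdgeAt? τ i j = onEdge? i j (τ i) (τ j)

  dot-normal : ∀ {x τ} → x ≈ Xρ τ → dot normal x ≡ count (onEdgeAt? τ)
  dot-normal {τ = τ} x≈Xτ = trans (dot-cong normal x≈Xτ) (dot-Xρ normal τ)

  normal-bounded : ∀ x → IsXρ x → dot normal x ≤ℚ cells n
  normal-bounded _ (τ , x≈Xτ) =
    ℚ.≤-trans (ℚ.≤-reflexive (dot-normal x≈Xτ)) (count≤cells (onEdgeAt? τ))

  normal-nonzero : Fin n → ¬ (normal ≈ zeroPt)
  normal-nonzero i normal≈0 =
    ℚ.1≢0 (trans (sym (⇒indicator≡1 (onEdge? i i (ρ i) (ρ i)) (inj₁ (refl , refl))))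
                 (normal≈0 i i (ρ i) (ρ i)))

  exposes : ∀ {X Y} → X ≈ Xρ ρ → Y ≈ Xρ σ →
    (λ x → x ≈ X ⊎ x ≈ Y) ≐ (λ x → IsXρ x × dot normal x ≡ cells n)
  exposes {X} {Y} X≈Xρ Y≈Xσ x = mk⇔ onFace fromFace
    where
    onFace : x ≈ X ⊎ x ≈ Y → IsXρ x × dot normal x ≡ cells n
    onFace (inj₁ x≈X) = let x≈Xρ = ≈-trans x≈X X≈Xρ in
      (ρ , x≈Xρ) , trans (dot-normal x≈Xρ) (⇒count≡cells (onEdgeAt? ρ) λ _ _ → inj₁ (refl , refl))
    onFace (inj₂ x≈Y) = let x≈Xσ = ≈-trans x≈Y Y≈Xσ in
      (σ , x≈Xσ) , trans (dot-normal x≈Xσ) (⇒count≡cells (onEdgeAt? σ) λ _ _ → inj₂ (refl , refl))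

    fromFace : IsXρ x × dot normal x ≡ cells n → x ≈ X ⊎ x ≈ Y
    fromFace ((τ , x≈Xτ) , eq)
      with onEdge⇒≗⊎≗ _≟_ (count≡cells⇒ (onEdgeAt? τ) (trans (sym (dot-normal x≈Xτ)) eq))
    ... | inj₁ τ≗ρ = inj₁ (≈-trans x≈Xτ (≈-trans (Xρ-cong τ≗ρ) (≈-sym X≈Xρ)))
    ... | inj₂ τ≗σ = inj₂ (≈-trans x≈Xτ (≈-trans (Xρ-cong τ≗σ) (≈-sym Y≈Xσ)))

theorem3 : (n : ℕ) → 2 ≤ n → (X Y : Point n) →
    IsVertex (Ω n) X → IsVertex (Ω n) Y → ¬ (X ≈ Y) →
    IsFace (Ω n) (Seg X Y)
theorem3 n 2≤n X Y vX vY _ with Ω-vertex vX | Ω-vertex vY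
... | ρ , X≈Xρ | σ , Y≈Xσ =
  inj₂ (inj₂ (normal , cells n , normal-nonzero (fromℕ< (≤-trans (s≤s z≤n) 2≤n)) ,
              InConv-bounded normal (cells n) normal-bounded , face))
  where
  open Edge ρ σ
  face : Seg X Y ≐ (λ z → Ω n z × dot normal z ≡ cells n)
  face z = ⇔-trans (InConv-cong (exposes X≈Xρ Y≈Xσ) z) (InConv-face normal (cells n) normal-bounded z)
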